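{- For nonnegative integers $s,t$, the complete bipartite graph $K_{s,t}$ satisfies \[ Q(K_{s,t};x,y)=(1+xy)^s+(1+xy)^t+\left[(1+x)^s-1\right]\left[(1+x)^t-1\right]y-1. \]
   Context: For a finite simple graph $G=(V,E)$, $Q(G;x,y)=\sum_{X\subseteq V}x^{|X|}y^{k(G[X])}$, where $G[X]$ is the induced subgraph and $k$ the number of connected components (the null graph has $k=0$). -}

module Defs where

open import Level using (Level)
open import Data.Nat using (ℕ; zero; suc; _+_; _<ᵇ_)
open import Data.Fin using (Fin; toℕ; _<_)
open import Data.Fin.Properties using (_<?_)
open import Data.Bool using (Bool; true; false; not; _∧_; _∨_; _xor_; if_then_else_; T)
open import Data.Bool.Properties using (xor-same; T?)
open import Data.Vec using (Vec; []; _∷_; lookup; tabulate)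
open import Data.List using (List; []; _∷_; map; _++_; foldr; filter; length; allFin)
open import Data.Bool.ListAction using (any)
open import Relation.Nullary using (¬_)
open import Relation.Nullary.Decidable using (⌊_⌋)
open import Relation.Binary.PropositionalEquality using (_≡_; refl)
open import Algebra.Bundles using (CommutativeRing)

record Graph (n : ℕ) : Set where
  field
    adj    : Fin n → Fin n → Bool
    symm   : ∀ u v → adj u v ≡ adj v u
    irrefl : ∀ v → adj v v ≡ false
open Graph public

Subset : ℕ → Set
Subset n = Vec Bool n

allSubsets : (n : ℕ) → List (Subset n)
allSubsets zero    = [] ∷ []
allSubsets (suc n) = map (false ∷_) (allSubsets n) ++ map (true ∷_) (allSubsets n)

_∈ᵇ_ : ∀ {n} → Fin n → Subset n → Bool
v ∈ᵇ X = lookup X v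

card : ∀ {n} → Subset n → ℕ
card []          = 0
card (true ∷ X)  = suc (card X)
card (false ∷ X) = card X

-- reachWithin G X k u v : there is a walk from u to v of length ≤ k
-- all of whose vertices lie in X (i.e. a walk in the induced subgraph G[X]).
reachWithin : ∀ {n} → Graph n → Subset n → ℕ → Fin n → Fin n → Bool
reachWithin G X zero    u v = (u ∈ᵇ X) ∧ (v ∈ᵇ X) ∧ ⌊ Data.Fin._≟_ u v ⌋
reachWithin G X (suc k) u v =
  reachWithin G X k u v ∨
  any (λ w → reachWithin G X k u w ∧ adj G w v ∧ (v ∈ᵇ X)) (allFin _)

-- u and v lie in the same connected component of G[X]
-- (walks of length ≤ n suffice in a graph with n vertices).
connectedIn : ∀ {n} → Graph n → Subset n → Fin n → Fin n → Bool
connectedIn {n} G X u v = reachWithin G X n u v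

isRep : ∀ {n} → Graph n → Subset n → Fin n → Bool
isRep G X v = (v ∈ᵇ X) ∧ not (any (λ u → ⌊ u <? v ⌋ ∧ connectedIn G X u v) (allFin _))

-- k(G[X]) : the number of connected components of the induced subgraph
-- G[X], counted via one (least) representative per component.
-- The null graph (X = ∅) has 0 components.
components : ∀ {n} → Graph n → Subset n → ℕ
components G X = length (filter (λ v → T? (isRep G X v)) (allFin _))

-- Complete bipartite graph K_{s,t} on Fin (s + t): vertices with index < s
-- form one side, the remaining t vertices the other side.
K : (s t : ℕ) → Graph (s + t)
K s t = record
  { adj    = λ u v → (toℕ u <ᵇ s) xor (toℕ v <ᵇ s)
  ; symm   = λ u v → xor-comm (toℕ u <ᵇ s) (toℕ v <ᵇ s)
  ; irrefl = λ v → xor-same (toℕ v <ᵇ s)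
  }
  where
  xor-comm : ∀ a b → a xor b ≡ b xor a
  xor-comm false false = refl
  xor-comm false true  = refl
  xor-comm true  false = refl
  xor-comm true  true  = refl

module _ {c ℓ : Level} (R : CommutativeRing c ℓ) where
  open CommutativeRing R using (Carrier; 0#; 1#) renaming (_+_ to _⊕_; _*_ to _⊛_)

  pow : Carrier → ℕ → Carrier
  pow a zero    = 1#
  pow a (suc m) = a ⊛ pow a m

  Q : ∀ {n} → Graph n → Carrier → Carrier → Carrier
  Q {n} G x y = foldr _⊕_ 0# (map (λ X → pow x (card X) ⊛ pow y (components G X)) (allSubsets n))

module Submission where

-- Q(K_{s,t}; x, y), computed by splitting every vertex set X of K_{s,t}
-- as X = A ++ B with A on the s-side and B on the t-side.
--
-- For an arbitrary graph G and vertex set X we show that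
-- k(G[X]) = |X| when X is independent, and k(G[X]) = 1 when X is
-- nonempty and any two of its vertices are joined by a walk inside X.
-- In K_{s,t} the first case occurs exactly when A or B is empty, the
-- second when both are nonempty (walks of length ≤ 2 suffice), so
-- k(G[A ++ B]) = κ |A| |B| for an explicit function κ.
--
-- Sums over all subsets are linear, split over s + t as a
-- double sum, and Σ_X c^{|X|} = (1 + c)^n.  The summand
-- x^{a+b} y^{κ a b} separates as a sum of three products f(a) g(b),
-- so the double sum factorises into single binomial sums, and the
-- closed form follows by a ring normalisation.

open import Defs
open import Level using (Level)
open import Algebra.Bundles using (CommutativeRing)
open import Data.Nat as ℕ using (ℕ; zero; suc; _≤_; _≤′_; ≤′-refl; ≤′-step; z≤n; s≤s; _<ᵇ_)
open import Data.Nat.Properties using (≤-trans; m≤n+m; ≤⇒≤′)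
import Data.Nat.Properties as ℕₚ
open import Data.Fin using (Fin; zero; suc; toℕ; _≟_; _↑ˡ_; _↑ʳ_)
open import Data.Fin.Properties using (_<?_; <-irrefl)
open import Data.Bool using (Bool; true; false; not; _∧_; _∨_; _xor_; T)
open import Data.Bool.Properties using (T?; T-∧; T-∨; ∧-zeroʳ; ∧-identityʳ)
open import Data.Bool.ListAction using (any; or)
open import Data.List as List using (List; []; _∷_; map; filter; length; allFin)
open import Data.List.Properties using (map-cong; map-tabulate; map-∘)
open import Data.List.Relation.Unary.Any using (satisfied)
open import Data.List.Relation.Unary.Any.Properties using (any⁺; any⁻)
open import Data.List.Membership.Propositional using (lose)
open import Data.List.Membership.Propositional.Properties using (∈-allFin)
open import Data.Vec as Vec using ([]; _∷_; lookup; _++_)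
open import Data.Vec.Properties using (tabulate-cong; tabulate∘lookup; lookup-++ˡ; lookup-++ʳ)
open import Data.Product using (∃-syntax; _×_; _,_; proj₁; proj₂)
open import Data.Sum using (_⊎_; inj₁; inj₂; [_,_]′)
open import Data.Empty using (⊥; ⊥-elim)
open import Function using (_∘_; Equivalence)
open import Relation.Nullary using (¬_)
open import Relation.Nullary.Decidable using (⌊_⌋; isYes≗does; toWitness; fromWitness)
open import Relation.Binary.PropositionalEquality
  using (_≡_; refl; sym; trans; cong; cong₂; subst)

open Equivalence using (to; from)

T-ext : ∀ {a b : Bool} → (T a → T b) → (T b → T a) → a ≡ b
T-ext {false} {false} _ _ = refl
T-ext {false} {true}  _ g = ⊥-elim (g _)
T-ext {true}  {false} f _ = ⊥-elim (f _)
T-ext {true}  {true}  _ _ = refl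

<?-toℕ : ∀ {n} (u v : Fin n) → ⌊ u <? v ⌋ ≡ (toℕ u <ᵇ toℕ v)
<?-toℕ u v = isYes≗does (u <? v)

any-cong : ∀ {A : Set} {p q : A → Bool} → (∀ a → p a ≡ q a) → ∀ xs → any p xs ≡ any q xs
any-cong p≗q xs = cong or (map-cong p≗q xs)

any-false : ∀ {A : Set} {p : A → Bool} xs → (∀ a → ¬ T (p a)) → any p xs ≡ false
any-false {p = p} xs never = T-ext (λ t → never _ (proj₂ (satisfied (any⁻ p xs t)))) (λ ())

any-allFin-suc : ∀ {n} (p : Fin (suc n) → Bool) →
  any p (allFin (suc n)) ≡ p zero ∨ any (p ∘ suc) (allFin n)
any-allFin-suc p = cong (p zero ∨_) (cong or
  (trans (map-tabulate suc p) (sym (map-tabulate (λ i → i) (p ∘ suc)))))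

count-tabulate : ∀ {A : Set} {n} (p : A → Bool) (f : Fin n → A) →
  length (filter (T? ∘ p) (List.tabulate f)) ≡ card (Vec.tabulate (p ∘ f))
count-tabulate {n = zero}  p f = refl
count-tabulate {n = suc n} p f with p (f zero)
... | true  = cong suc (count-tabulate p (f ∘ suc))
... | false = count-tabulate p (f ∘ suc)

card-all-false : ∀ n → card (Vec.tabulate {n = n} (λ _ → false)) ≡ 0
card-all-false zero    = refl
card-all-false (suc n) = card-all-false n

least : ∀ {n} → Subset n → Fin n → Bool
least {n} X v = v ∈ᵇ X ∧ not (any (λ u → ⌊ u <? v ⌋ ∧ u ∈ᵇ X) (allFin n))

least-zero : ∀ {n} b (X : Subset n) → least (b ∷ X) zero ≡ b
least-zero {n} b X =
  trans (cong (λ z → b ∧ not z) (any-false (allFin _) nothing-below-zero)) (∧-identityʳ b)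
  where
  nothing-below-zero : ∀ (u : Fin (suc n)) → ¬ T (⌊ u <? zero {n} ⌋ ∧ lookup (b ∷ X) u)
  nothing-below-zero u t
    with () ← toWitness {a? = u <? zero {n}} (proj₁ (to (T-∧ {y = lookup (b ∷ X) u}) t))

least-suc : ∀ {n} b (X : Subset n) v → least (b ∷ X) (suc v) ≡ not b ∧ least X v
least-suc {n} b X v =
  trans (cong (λ z → lookup X v ∧ not z)
              (trans (any-allFin-suc (λ u → ⌊ u <? suc v ⌋ ∧ lookup (b ∷ X) u))
                     (cong₂ _∨_ zero-below (any-cong shift (allFin n)))))
        (absorb b)
  where
  below : Bool
  below = any (λ u → ⌊ u <? v ⌋ ∧ lookup X u) (allFin n)
  zero-below : (⌊ zero {n} <? suc v ⌋ ∧ b) ≡ b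
  zero-below = cong (_∧ b) (<?-toℕ zero (suc v))
  shift : ∀ u → (⌊ suc u <? suc v ⌋ ∧ lookup X u) ≡ (⌊ u <? v ⌋ ∧ lookup X u)
  shift u = cong (_∧ lookup X u) (trans (<?-toℕ (suc u) (suc v)) (sym (<?-toℕ u v)))
  absorb : ∀ b → (lookup X v ∧ not (b ∨ below)) ≡ (not b ∧ (lookup X v ∧ not below))
  absorb true  = ∧-zeroʳ (lookup X v)
  absorb false = refl

card-least : ∀ {n} (X : Subset n) → ∃[ v ] T (v ∈ᵇ X) → card (Vec.tabulate (least X)) ≡ 1
card-least []      (() , _)
card-least {suc n} (b ∷ X) member =
  trans (cong card (cong₂ _∷_ (least-zero b X) (tabulate-cong (least-suc b X)))) (count b member)
  where
  count : ∀ b → ∃[ v ] T (v ∈ᵇ (b ∷ X)) → card (b ∷ Vec.tabulate (λ v → not b ∧ least X v)) ≡ 1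
  count true  _           = cong suc (card-all-false n)
  count false (zero , ())
  count false (suc v , t) = card-least X (v , t)

module Walks {n : ℕ} (G : Graph n) (X : Subset n) where

  reach : ℕ → Fin n → Fin n → Set
  reach k u v = T (reachWithin G X k u v)

  Independent : Set
  Independent = ∀ {u v} → T (u ∈ᵇ X) → T (v ∈ᵇ X) → ¬ T (adj G u v)

  Connected : Set
  Connected = ∀ {u v} → T (u ∈ᵇ X) → T (v ∈ᵇ X) → T (connectedIn G X u v)

  reach-suc⁻ : ∀ k {u v} → reach (suc k) u v →
    reach k u v ⊎ ∃[ w ] (reach k u w × T (adj G w v) × T (v ∈ᵇ X))
  reach-suc⁻ k r with to T-∨ r
  ... | inj₁ r′ = inj₁ r′
  ... | inj₂ t with satisfied (any⁻ _ (allFin n) t)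
  ... | w , step with to T-∧ step
  ... | rw , edge-in with to T-∧ edge-in
  ... | e , v∈X = inj₂ (w , rw , e , v∈X)

  reach-refl : ∀ {u} → T (u ∈ᵇ X) → reach 0 u u
  reach-refl {u} u∈X = from T-∧ (u∈X , from T-∧ (u∈X , fromWitness {a? = u ≟ u} refl))

  reach-step : ∀ k {u w v} → reach k u w → T (adj G w v) → T (v ∈ᵇ X) → reach (suc k) u v
  reach-step k {w = w} rw e v∈X =
    from T-∨ (inj₂ (any⁺ _ (lose (∈-allFin w) (from T-∧ (rw , from T-∧ (e , v∈X))))))

  reach-mono : ∀ k {m u v} → k ≤′ m → reach k u v → reach m u v
  reach-mono k ≤′-refl       r = r
  reach-mono k (≤′-step k≤m) r = from T-∨ (inj₁ (reach-mono k k≤m r))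

  edge-walk : ∀ {u v} → T (u ∈ᵇ X) → T (adj G u v) → T (v ∈ᵇ X) → reach 1 u v
  edge-walk u∈X e v∈X = reach-step 0 (reach-refl u∈X) e v∈X

  path-walk : ∀ {u w v} → T (u ∈ᵇ X) → T (adj G u w) → T (w ∈ᵇ X) → T (adj G w v) → T (v ∈ᵇ X) →
    reach 2 u v
  path-walk u∈X e w∈X e′ v∈X = reach-step 1 (edge-walk u∈X e w∈X) e′ v∈X

  reach-source : ∀ k {u v} → reach k u v → T (u ∈ᵇ X)
  reach-source zero    r = proj₁ (to T-∧ r)
  reach-source (suc k) r with reach-suc⁻ k r
  ... | inj₁ r′            = reach-source k r′
  ... | inj₂ (_ , rw , _) = reach-source k rw

  reach-independent : Independent → ∀ k {u v} → reach k u v → u ≡ v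
  reach-independent ind zero {u} {v} r =
    toWitness {a? = u ≟ v} (proj₂ (to (T-∧ {v ∈ᵇ X}) (proj₂ (to (T-∧ {u ∈ᵇ X}) r))))
  reach-independent ind (suc k) r with reach-suc⁻ k r
  ... | inj₁ r′                 = reach-independent ind k r′
  ... | inj₂ (w , rw , e , v∈X) with reach-independent ind k rw
  ... | refl = ⊥-elim (ind (reach-source k rw) v∈X e)

  components-count : components G X ≡ card (Vec.tabulate (isRep G X))
  components-count = count-tabulate (isRep G X) (λ v → v)

  components-independent : Independent → components G X ≡ card X
  components-independent ind =
    trans components-count
      (trans (cong card (tabulate-cong every-vertex-rep)) (cong card (tabulate∘lookup X)))
    where
    every-vertex-rep : ∀ v → isRep G X v ≡ lookup X v
    every-vertex-rep v =
      trans (cong (λ z → lookup X v ∧ not z) (any-false (allFin n) nothing-earlier)) (∧-identityʳ _)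
      where
      nothing-earlier : ∀ u → ¬ T (⌊ u <? v ⌋ ∧ connectedIn G X u v)
      nothing-earlier u t with to (T-∧ {⌊ u <? v ⌋}) t
      ... | u<v , r = <-irrefl (reach-independent ind n r) (toWitness u<v)

  components-connected : ∃[ v ] T (v ∈ᵇ X) → Connected → components G X ≡ 1
  components-connected member conn =
    trans components-count (trans (cong card (tabulate-cong rep-is-least)) (card-least X member))
    where
    rep-is-least : ∀ v → isRep G X v ≡ least X v
    rep-is-least v with lookup X v in v∈X
    ... | false = refl
    ... | true  =
      cong not (any-cong (λ u → cong (⌊ u <? v ⌋ ∧_) (connected-iff-member u)) (allFin n))
      where
      connected-iff-member : ∀ u → connectedIn G X u v ≡ lookup X u
      connected-iff-member u =
        T-ext (reach-source n) (λ u∈X → conn u∈X (subst T (sym v∈X) _))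

card-++ : ∀ {s t} (A : Subset s) (B : Subset t) → card (A ++ B) ≡ card A ℕ.+ card B
card-++ []          B = refl
card-++ (true ∷ A)  B = cong suc (card-++ A B)
card-++ (false ∷ A) B = card-++ A B

card-zero⇒empty : ∀ {s} (A : Subset s) → card A ≡ 0 → ∀ i → ¬ T (lookup A i)
card-zero⇒empty (false ∷ A) empty zero    ()
card-zero⇒empty (false ∷ A) empty (suc i) = card-zero⇒empty A empty i

card-suc⇒member : ∀ {s m} (A : Subset s) → card A ≡ suc m → ∃[ i ] T (lookup A i)
card-suc⇒member (true ∷ A)  _        = zero , _
card-suc⇒member (false ∷ A) nonempty with card-suc⇒member A nonempty
... | i , i∈A = suc i , i∈A

data Side (s t : ℕ) : Fin (s ℕ.+ t) → Set where
  left  : (i : Fin s) → Side s t (i ↑ˡ t)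
  right : (j : Fin t) → Side s t (s ↑ʳ j)

side : ∀ s t (v : Fin (s ℕ.+ t)) → Side s t v
side zero    t v       = right v
side (suc s) t zero    = left zero
side (suc s) t (suc v) with side s t v
... | left i  = left (suc i)
... | right j = right j

on-left : ∀ {s t v} → Side s t v → Bool
on-left (left _)  = true
on-left (right _) = false

on-left-correct : ∀ {s t v} (p : Side s t v) → (toℕ v <ᵇ s) ≡ on-left p
on-left-correct {t = t} (left i) = below i
  where
  below : ∀ {s} (i : Fin s) → (toℕ (i ↑ˡ t) <ᵇ s) ≡ true
  below zero    = refl
  below (suc i) = below i
on-left-correct {s} (right j) = not-below s
  where
  not-below : ∀ s → (toℕ (s ↑ʳ j) <ᵇ s) ≡ false
  not-below zero    = refl
  not-below (suc s) = not-below s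

K-adj : ∀ {s t u v} (p : Side s t u) (q : Side s t v) →
  adj (K s t) u v ≡ (on-left p xor on-left q)
K-adj p q = cong₂ _xor_ (on-left-correct p) (on-left-correct q)

K-edge : ∀ {s t} (i : Fin s) (j : Fin t) → T (adj (K s t) (i ↑ˡ t) (s ↑ʳ j))
K-edge i j = subst T (sym (K-adj (left i) (right j))) _

K-edge′ : ∀ {s t} (j : Fin t) (i : Fin s) → T (adj (K s t) (s ↑ʳ j) (i ↑ˡ t))
K-edge′ j i = subst T (sym (K-adj (right j) (left i))) _

two-sides : ∀ {s t} → Fin s → Fin t → 2 ≤ s ℕ.+ t
two-sides {suc s} {suc t} _ _ = s≤s (≤-trans (s≤s z≤n) (m≤n+m (suc t) s))

-- The number of components of K_{s,t}[A ++ B] in terms of |A| and |B|.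
κ : ℕ → ℕ → ℕ
κ zero    b       = b
κ (suc a) zero    = suc a
κ (suc a) (suc b) = 1

module _ {s t : ℕ} (A : Subset s) (B : Subset t) where
  open Walks (K s t) (A ++ B)

  in-left : ∀ {i} → T (lookup A i) → T (lookup (A ++ B) (i ↑ˡ t))
  in-left {i} = subst T (sym (lookup-++ˡ A B i))

  in-right : ∀ {j} → T (lookup B j) → T (lookup (A ++ B) (s ↑ʳ j))
  in-right {j} = subst T (sym (lookup-++ʳ A B j))

  K-independent : card A ≡ 0 ⊎ card B ≡ 0 → Independent
  K-independent one-empty {u} {v} = edge-free (side s t u) (side s t v)
    where
    both-nonempty : ∀ {i j} → T (lookup A i) → T (lookup B j) → ⊥
    both-nonempty {i} {j} i∈A j∈B =
      [ (λ A-empty → card-zero⇒empty A A-empty i i∈A)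
      , (λ B-empty → card-zero⇒empty B B-empty j j∈B) ]′ one-empty
    edge-free : ∀ {u v} → Side s t u → Side s t v →
      T (lookup (A ++ B) u) → T (lookup (A ++ B) v) → ¬ T (adj (K s t) u v)
    edge-free p@(left _)  q@(left _)  _ _ e = subst T (K-adj p q) e
    edge-free p@(right _) q@(right _) _ _ e = subst T (K-adj p q) e
    edge-free (left i)  (right j) i∈ j∈ _ =
      both-nonempty (subst T (lookup-++ˡ A B i) i∈) (subst T (lookup-++ʳ A B j) j∈)
    edge-free (right j) (left i)  j∈ i∈ _ =
      both-nonempty (subst T (lookup-++ˡ A B i) i∈) (subst T (lookup-++ʳ A B j) j∈)

  -- If both sides are nonempty, any two vertices of A ++ B are joined by
  -- a walk of length ≤ 2 through a vertex of the other side.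
  K-connected : ∀ {a b} → card A ≡ suc a → card B ≡ suc b → Connected
  K-connected A-nonempty B-nonempty {u} {v} u∈ v∈
    with card-suc⇒member A A-nonempty | card-suc⇒member B B-nonempty
  ... | i₀ , i₀∈A | j₀ , j₀∈B =
    reach-mono 2 (≤⇒≤′ (two-sides i₀ j₀)) (walk (side s t u) (side s t v) u∈ v∈)
    where
    i₀∈ : T (lookup (A ++ B) (i₀ ↑ˡ t))
    i₀∈ = in-left i₀∈A
    j₀∈ : T (lookup (A ++ B) (s ↑ʳ j₀))
    j₀∈ = in-right j₀∈B
    walk : ∀ {u v} → Side s t u → Side s t v →
      T (lookup (A ++ B) u) → T (lookup (A ++ B) v) → reach 2 u v
    walk (left i)  (left i′)  u∈ v∈ = path-walk u∈ (K-edge i j₀) j₀∈ (K-edge′ j₀ i′) v∈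
    walk (right j) (right j′) u∈ v∈ = path-walk u∈ (K-edge′ j i₀) i₀∈ (K-edge i₀ j′) v∈
    walk (left i)  (right j)  u∈ v∈ = reach-mono 1 (≤′-step ≤′-refl) (edge-walk u∈ (K-edge i j) v∈)
    walk (right j) (left i)   u∈ v∈ = reach-mono 1 (≤′-step ≤′-refl) (edge-walk u∈ (K-edge′ j i) v∈)

  K-components : components (K s t) (A ++ B) ≡ κ (card A) (card B)
  K-components with card A in A-card | card B in B-card
  ... | zero  | _     = trans (components-independent (K-independent (inj₁ A-card)))
                              (trans (card-++ A B) (cong₂ ℕ._+_ A-card B-card))
  ... | suc a | zero  = trans (components-independent (K-independent (inj₂ B-card)))
                              (trans (card-++ A B)
                                     (trans (cong₂ ℕ._+_ A-card B-card) (ℕₚ.+-identityʳ (suc a))))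
  ... | suc _ | suc _ = components-connected member (K-connected A-card B-card)
    where
    member : ∃[ v ] T (lookup (A ++ B) v)
    member with card-suc⇒member A A-card
    ... | i , i∈A = i ↑ˡ t , in-left i∈A

module Sums {c ℓ : Level} (R : CommutativeRing c ℓ) where
  open CommutativeRing R renaming (refl to ≈-refl; sym to ≈-sym; trans to ≈-trans)
  open import Algebra.Properties.CommutativeSemigroup +-commutativeSemigroup using (interchange)
  open import Algebra.Properties.Group +-group using (x≈z//y)
  open import Algebra.Properties.Semiring.Exp semiring using (_^_; ^-homo-*)
  open import Algebra.Properties.CommutativeSemiring.Exp commutativeSemiring using (^-distrib-*)
  open import Relation.Binary.Reasoning.Setoid setoid

  ∑ : ∀ {A : Set} → List A → (A → Carrier) → Carrier
  ∑ l f = List.foldr _+_ 0# (map f l)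

  ∑-cong : ∀ {A : Set} (l : List A) {f g : A → Carrier} → (∀ a → f a ≈ g a) → ∑ l f ≈ ∑ l g
  ∑-cong []      _   = ≈-refl
  ∑-cong (a ∷ l) f≈g = +-cong (f≈g a) (∑-cong l f≈g)

  ∑-zero : ∀ {A : Set} (l : List A) → ∑ l (λ _ → 0#) ≈ 0#
  ∑-zero []      = ≈-refl
  ∑-zero (a ∷ l) = ≈-trans (+-identityˡ _) (∑-zero l)

  ∑-+ : ∀ {A : Set} (l : List A) f g → ∑ l (λ a → f a + g a) ≈ ∑ l f + ∑ l g
  ∑-+ []      f g = ≈-sym (+-identityˡ 0#)
  ∑-+ (a ∷ l) f g = ≈-trans (+-congˡ (∑-+ l f g)) (interchange (f a) (g a) (∑ l f) (∑ l g))

  ∑-*ˡ : ∀ {A : Set} (l : List A) k f → ∑ l (λ a → k * f a) ≈ k * ∑ l f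
  ∑-*ˡ []      k f = ≈-sym (zeroʳ k)
  ∑-*ˡ (a ∷ l) k f = ≈-trans (+-congˡ (∑-*ˡ l k f)) (≈-sym (distribˡ k (f a) (∑ l f)))

  ∑-*ʳ : ∀ {A : Set} (l : List A) k f → ∑ l (λ a → f a * k) ≈ ∑ l f * k
  ∑-*ʳ []      k f = ≈-sym (zeroˡ k)
  ∑-*ʳ (a ∷ l) k f = ≈-trans (+-congˡ (∑-*ʳ l k f)) (≈-sym (distribʳ k (f a) (∑ l f)))

  ∑-++ : ∀ {A : Set} (l m : List A) f → ∑ (l List.++ m) f ≈ ∑ l f + ∑ m f
  ∑-++ []      m f = ≈-sym (+-identityˡ _)
  ∑-++ (a ∷ l) m f = ≈-trans (+-congˡ (∑-++ l m f)) (≈-sym (+-assoc _ _ _))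

  ∑-map : ∀ {A B : Set} (h : A → B) (l : List A) f → ∑ (map h l) f ≈ ∑ l (f ∘ h)
  ∑-map h l f = reflexive (cong (List.foldr _+_ 0#) (sym (map-∘ l)))

  ∑∑-+ : ∀ {A B : Set} (l : List A) (m : List B) (f g : A → B → Carrier) →
    ∑ l (λ a → ∑ m (λ b → f a b + g a b)) ≈ ∑ l (λ a → ∑ m (f a)) + ∑ l (λ a → ∑ m (g a))
  ∑∑-+ l m f g = ≈-trans (∑-cong l (λ a → ∑-+ m (f a) (g a))) (∑-+ l _ _)

  ∑∑-separable : ∀ {A B : Set} (l : List A) (m : List B) f g →
    ∑ l (λ a → ∑ m (λ b → f a * g b)) ≈ ∑ l f * ∑ m g
  ∑∑-separable l m f g = ≈-trans (∑-cong l (λ a → ∑-*ˡ m (f a) g)) (∑-*ʳ l (∑ m g) f)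

  ∑∑-separable₃ : ∀ {A B : Set} (l : List A) (m : List B) f₁ g₁ f₂ g₂ f₃ g₃ →
    ∑ l (λ a → ∑ m (λ b → f₁ a * g₁ b + f₂ a * g₂ b + f₃ a * g₃ b)) ≈
      ∑ l f₁ * ∑ m g₁ + ∑ l f₂ * ∑ m g₂ + ∑ l f₃ * ∑ m g₃
  ∑∑-separable₃ l m f₁ g₁ f₂ g₂ f₃ g₃ =
    ≈-trans (∑∑-+ l m (λ a b → f₁ a * g₁ b + f₂ a * g₂ b) (λ a b → f₃ a * g₃ b))
    (+-cong (≈-trans (∑∑-+ l m (λ a b → f₁ a * g₁ b) (λ a b → f₂ a * g₂ b))
                     (+-cong (∑∑-separable l m f₁ g₁) (∑∑-separable l m f₂ g₂)))
            (∑∑-separable l m f₃ g₃))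

  ∑⊆ : ∀ n → (Subset n → Carrier) → Carrier
  ∑⊆ n = ∑ (allSubsets n)

  ∑⊆-suc : ∀ n f → ∑⊆ (suc n) f ≈ ∑⊆ n (f ∘ (false ∷_)) + ∑⊆ n (f ∘ (true ∷_))
  ∑⊆-suc n f = ≈-trans (∑-++ (map (false ∷_) (allSubsets n)) _ f)
    (+-cong (∑-map (false ∷_) (allSubsets n) f) (∑-map (true ∷_) (allSubsets n) f))

  ∑⊆-++ : ∀ s t F → ∑⊆ (s ℕ.+ t) F ≈ ∑⊆ s (λ A → ∑⊆ t (λ B → F (A ++ B)))
  ∑⊆-++ zero    t F = ≈-sym (+-identityʳ _)
  ∑⊆-++ (suc s) t F =
    ≈-trans (∑⊆-suc (s ℕ.+ t) F)
            (≈-trans (+-cong (∑⊆-++ s t _) (∑⊆-++ s t _)) (≈-sym (∑⊆-suc s _)))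

  ∑⊆-binomial : ∀ n k → ∑⊆ n (λ X → pow R k (card X)) ≈ pow R (1# + k) n
  ∑⊆-binomial zero    k = +-identityʳ 1#
  ∑⊆-binomial (suc n) k = begin
    ∑⊆ (suc n) (λ X → pow R k (card X))
      ≈⟨ ∑⊆-suc n _ ⟩
    ∑⊆ n (λ X → pow R k (card X)) + ∑⊆ n (λ X → k * pow R k (card X))
      ≈⟨ +-cong (∑⊆-binomial n k) (≈-trans (∑-*ˡ (allSubsets n) k _) (*-congˡ (∑⊆-binomial n k))) ⟩
    pow R (1# + k) n + k * pow R (1# + k) n
      ≈⟨ +-congʳ (*-identityˡ _) ⟨
    1# * pow R (1# + k) n + k * pow R (1# + k) n
      ≈⟨ distribʳ _ 1# k ⟨
    (1# + k) * pow R (1# + k) n ∎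

  -- δ n = [n = 0] and ε k n = [n > 0] k^n split k^n by emptiness.
  δ : ℕ → Carrier
  δ zero    = 1#
  δ (suc _) = 0#

  ε : Carrier → ℕ → Carrier
  ε k zero    = 0#
  ε k (suc n) = pow R k (suc n)

  δ+ε : ∀ k n → δ n + ε k n ≈ pow R k n
  δ+ε k zero    = +-identityʳ 1#
  δ+ε k (suc n) = +-identityˡ _

  ∑⊆-δ : ∀ n → ∑⊆ n (δ ∘ card) ≈ 1#
  ∑⊆-δ zero    = +-identityʳ 1#
  ∑⊆-δ (suc n) =
    ≈-trans (∑⊆-suc n _) (≈-trans (+-cong (∑⊆-δ n) (∑-zero (allSubsets n))) (+-identityʳ 1#))

  ∑⊆-ε : ∀ n k → ∑⊆ n (ε k ∘ card) ≈ pow R (1# + k) n - 1#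
  ∑⊆-ε n k = x≈z//y _ 1# _ (begin
    ∑⊆ n (ε k ∘ card) + 1#                  ≈⟨ +-comm _ 1# ⟩
    1# + ∑⊆ n (ε k ∘ card)                  ≈⟨ +-congʳ (∑⊆-δ n) ⟨
    ∑⊆ n (δ ∘ card) + ∑⊆ n (ε k ∘ card)     ≈⟨ ∑-+ (allSubsets n) (δ ∘ card) (ε k ∘ card) ⟨
    ∑⊆ n (λ X → δ (card X) + ε k (card X))  ≈⟨ ∑-cong (allSubsets n) (λ X → δ+ε k (card X)) ⟩
    ∑⊆ n (λ X → pow R k (card X))           ≈⟨ ∑⊆-binomial n k ⟩
    pow R (1# + k) n                        ∎)

  pow≡^ : ∀ a n → pow R a n ≡ a ^ n
  pow≡^ a zero    = refl
  pow≡^ a (suc n) = cong (a *_) (pow≡^ a n)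

  pow-distrib : ∀ a b n → pow R (a * b) n ≈ pow R a n * pow R b n
  pow-distrib a b n = ≈-trans (reflexive (pow≡^ (a * b) n))
    (≈-trans (^-distrib-* a b n) (reflexive (sym (cong₂ _*_ (pow≡^ a n) (pow≡^ b n)))))

  pow-homo : ∀ a m n → pow R a (m ℕ.+ n) ≈ pow R a m * pow R a n
  pow-homo a m n = ≈-trans (reflexive (pow≡^ a (m ℕ.+ n)))
    (≈-trans (^-homo-* a m n) (reflexive (sym (cong₂ _*_ (pow≡^ a m) (pow≡^ a n)))))

module KSummand {c ℓ : Level} (R : CommutativeRing c ℓ) where
  open CommutativeRing R renaming (refl to ≈-refl; sym to ≈-sym; trans to ≈-trans)
  open Sums R
  open import Algebra.Solver.Ring.NaturalCoefficients.Default commutativeSemiring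
    using (solve; _:+_; _:*_; _:=_; con)

  separate : ∀ x y a b → pow R x (a ℕ.+ b) * pow R y (κ a b) ≈
    δ a * ε (x * y) b + pow R (x * y) a * δ b + (y * ε x a) * ε x b
  separate x y zero zero =
    solve 1 (λ y → con 1 :* con 1 := con 1 :* con 0 :+ con 1 :* con 1 :+ (y :* con 0) :* con 0)
      ≈-refl y
  separate x y zero (suc b) = ≈-trans (≈-sym (pow-distrib x y (suc b)))
    (solve 3 (λ U y X → U := con 1 :* U :+ con 1 :* con 0 :+ (y :* con 0) :* X)
      ≈-refl (pow R (x * y) (suc b)) y (pow R x (suc b)))
  separate x y (suc a) zero =
    ≈-trans (*-congʳ (reflexive (cong (pow R x) (ℕₚ.+-identityʳ (suc a)))))
    (≈-trans (≈-sym (pow-distrib x y (suc a)))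
    (solve 3 (λ U y X → U := con 0 :* con 0 :+ U :* con 1 :+ (y :* X) :* con 0)
      ≈-refl (pow R (x * y) (suc a)) y (pow R x (suc a))))
  separate x y (suc a) (suc b) = ≈-trans (*-congʳ (pow-homo x (suc a) (suc b)))
    (solve 5 (λ Xa Xb y Ua Ub → (Xa :* Xb) :* (y :* con 1)
                                 := con 0 :* Ub :+ Ua :* con 0 :+ (y :* Xa) :* Xb)
      ≈-refl (pow R x (suc a)) (pow R x (suc b)) y (pow R (x * y) (suc a)) (pow R (x * y) (suc b)))

  K-summand : ∀ {s t} x y (A : Subset s) (B : Subset t) →
    pow R x (card (A ++ B)) * pow R y (components (K s t) (A ++ B)) ≈
      δ (card A) * ε (x * y) (card B) + pow R (x * y) (card A) * δ (card B)
        + (y * ε x (card A)) * ε x (card B)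
  K-summand x y A B =
    ≈-trans (reflexive (cong₂ (λ m k → pow R x m * pow R y k) (card-++ A B) (K-components A B)))
            (separate x y (card A) (card B))

  closed-form : ∀ Us Ut Px Qx y →
    1# * (Ut - 1#) + Us * 1# + (y * (Px - 1#)) * (Qx - 1#) ≈
      (Us + Ut + ((Px - 1#) * (Qx - 1#)) * y) - 1#
  closed-form Us Ut Px Qx y =
    solve 6 (λ Us Ut Px Qx y m → con 1 :* (Ut :+ m) :+ Us :* con 1 :+ (y :* (Px :+ m)) :* (Qx :+ m)
                               := Us :+ Ut :+ ((Px :+ m) :* (Qx :+ m)) :* y :+ m)
            ≈-refl Us Ut Px Qx y (- 1#)

corollary5p8 : {c ℓ : Level} (R : CommutativeRing c ℓ) (s t : ℕ) →
    let open CommutativeRing R in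
    (x y : Carrier) →
    Q R (K s t) x y ≈
      (pow R (1# + x * y) s + pow R (1# + x * y) t
        + ((pow R (1# + x) s - 1#) * (pow R (1# + x) t - 1#)) * y) - 1#
corollary5p8 R s t x y = begin
    Q R (K s t) x y
  ≈⟨ ∑⊆-++ s t _ ⟩
    ∑⊆ s (λ A → ∑⊆ t (λ B → pow R x (card (A ++ B)) * pow R y (components (K s t) (A ++ B))))
  ≈⟨ ∑-cong (allSubsets s) (λ A → ∑-cong (allSubsets t) (K-summand x y A)) ⟩
    ∑⊆ s (λ A → ∑⊆ t (λ B → δ (card A) * ε u (card B) + pow R u (card A) * δ (card B)
                             + (y * ε x (card A)) * ε x (card B)))
  ≈⟨ ∑∑-separable₃ (allSubsets s) (allSubsets t) _ _ _ _ _ _ ⟩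
    ∑⊆ s (δ ∘ card) * ∑⊆ t (ε u ∘ card) + ∑⊆ s (pow R u ∘ card) * ∑⊆ t (δ ∘ card)
      + ∑⊆ s (λ A → y * ε x (card A)) * ∑⊆ t (ε x ∘ card)
  ≈⟨ +-cong (+-cong (*-cong (∑⊆-δ s) (∑⊆-ε t u)) (*-cong (∑⊆-binomial s u) (∑⊆-δ t)))
            (*-cong (≈-trans (∑-*ˡ (allSubsets s) y _) (*-congˡ (∑⊆-ε s x))) (∑⊆-ε t x)) ⟩
    1# * (pow R (1# + u) t - 1#) + pow R (1# + u) s * 1#
      + (y * (pow R (1# + x) s - 1#)) * (pow R (1# + x) t - 1#)
  ≈⟨ closed-form _ _ _ _ y ⟩
    (pow R (1# + u) s + pow R (1# + u) t + ((pow R (1# + x) s - 1#) * (pow R (1# + x) t - 1#)) * y) - 1#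
  ∎
  where
  open CommutativeRing R renaming (trans to ≈-trans)
  open Sums R
  open KSummand R
  open import Relation.Binary.Reasoning.Setoid setoid
  u : Carrier
  u = x * y
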